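{- For every $n\ge1$, the periodic points of the map $s_{\{312,321\}}:S_n\to S_n$ are exactly the half-increasing permutations of length $n$.
   Context: A point $a$ is periodic for $f:A\to A$ if $f^k(a)=a$ for some integer $k>0$. A permutation $\pi$ of length $n$ is half-decreasing if the subsequence $\pi(n-1)\pi(n-3)\cdots\pi(2)$ (for odd $n$), respectively $\pi(n-1)\pi(n-3)\cdots\pi(3)$ (for even $n$), is literally equal to $1\,2\cdots\lfloor\frac{n-1}{2}\rfloor$. The complement of $\pi$ is $\pi^c=(n+1-\pi(1))\cdots(n+1-\pi(n))$, and $\pi$ is half-increasing if $\pi^c$ is half-decreasing. A sequence of distinct integers contains a permutation $\tau$ if some subsequence is order-isomorphic to $\tau$; otherwise it avoids $\tau$. For a set $T$ of permutations, the map $s_T$ is defined by: read the input permutation left to right with an initially empty stack and output; at each step, if there is a next input element and pushing it keeps the stack contents, read from top to bottom, $T$-avoiding, push it; otherwise pop the top of the stack and append it to the output; stop when input and stack are empty; the output is $s_T(\pi)$. -}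

module Defs where

open import Data.Nat using (ℕ; zero; suc; _+_; _*_; _∸_; _<ᵇ_; _<_)
open import Data.Nat.DivMod using (_/_)
open import Data.Bool using (Bool; true; false; _∧_; not; if_then_else_)
open import Data.Bool.Properties using () renaming (_≟_ to _≟ᵇ_)
open import Data.List using (List; []; _∷_; _++_; map; upTo; [_])
open import Data.Bool.ListAction using (all; any)
open import Data.List.Relation.Binary.Permutation.Propositional using (_↭_)
open import Data.Product using (∃; _×_)
open import Relation.Binary.PropositionalEquality using (_≡_)
open import Relation.Nullary.Decidable using (⌊_⌋)

_==_ : Bool → Bool → Bool
a == b = ⌊ a ≟ᵇ b ⌋

subseqs : List ℕ → List (List ℕ)
subseqs []       = [] ∷ []
subseqs (x ∷ xs) = map (x ∷_) (subseqs xs) ++ subseqs xs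

orderIso : List ℕ → List ℕ → Bool
orderIso []       []       = true
orderIso []       (_ ∷ _)  = false
orderIso (_ ∷ _)  []       = false
orderIso (x ∷ xs) (y ∷ ys) = agree xs ys ∧ orderIso xs ys
  where
  agree : List ℕ → List ℕ → Bool
  agree []        []        = true
  agree (x' ∷ xs') (y' ∷ ys') =
    (((x <ᵇ x') == (y <ᵇ y')) ∧ ((x' <ᵇ x) == (y' <ᵇ y))) ∧ agree xs' ys'
  agree _         _         = false

contains : List ℕ → List ℕ → Bool
contains σ τ = any (orderIso τ) (subseqs σ)

avoidsAll : List (List ℕ) → List ℕ → Bool
avoidsAll T σ = all (λ τ → not (contains σ τ)) T

-- The stack is a list whose head is the top,
-- so the stack read from top to bottom is the list itself.
-- Arguments: remaining input, stack, output so far.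
-- (If the stack is empty and pushing is forbidden -- impossible for pattern
--  sets of patterns of length >= 2 -- we push anyway to keep s_T total.)
stackRun : List (List ℕ) → List ℕ → List ℕ → List ℕ → List ℕ
stackRun T []       stack       out = out ++ stack
stackRun T (x ∷ xs) []          out = stackRun T xs (x ∷ []) out
stackRun T (x ∷ xs) (t ∷ stack) out =
  if avoidsAll T (x ∷ t ∷ stack)
  then stackRun T xs (x ∷ t ∷ stack) out
  else stackRun T (x ∷ xs) stack (out ++ [ t ])

sT : List (List ℕ) → List ℕ → List ℕ
sT T π = stackRun T π [] []

T312-321 : List (List ℕ)
T312-321 = (3 ∷ 1 ∷ 2 ∷ []) ∷ (3 ∷ 2 ∷ 1 ∷ []) ∷ []

IsPerm : ℕ → List ℕ → Set
IsPerm n π = π ↭ map suc (upTo n)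

iter : ℕ → (List ℕ → List ℕ) → List ℕ → List ℕ
iter zero    f x = x
iter (suc k) f x = f (iter k f x)

Periodic : (List ℕ → List ℕ) → List ℕ → Set
Periodic f a = ∃ λ k → 0 < k × iter k f a ≡ a

-- 1-based access π(p); value 0 outside the range (never used in range)
at : List ℕ → ℕ → ℕ
at []       _             = 0
at (x ∷ xs) zero          = 0
at (x ∷ xs) (suc zero)    = x
at (x ∷ xs) (suc (suc p)) = at xs (suc p)

-- the subsequence π(n-1) π(n-3) ... , i.e. π(n+1-2i) for i = 1 .. ⌊(n-1)/2⌋
-- (ending at π(2) for odd n and at π(3) for even n)
halfSeq : ℕ → List ℕ → List ℕ
halfSeq n π = map (λ i → at π (n + 1 ∸ 2 * suc i)) (upTo ((n ∸ 1) / 2))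

HalfDecreasing : ℕ → List ℕ → Set
HalfDecreasing n π = halfSeq n π ≡ map suc (upTo ((n ∸ 1) / 2))

complement : ℕ → List ℕ → List ℕ
complement n π = map (λ x → n + 1 ∸ x) π

HalfIncreasing : ℕ → List ℕ → Set
HalfIncreasing n π = HalfDecreasing n (complement n π)

-- Pushing x onto a {312,321}-avoiding stack S keeps it avoiding iff S has no two distinct entries
-- below x, so s = s_{312,321} is an ordinary stack machine with this push rule.
--
-- Say π = I ++ [f, e₁, f+1, e₂, …, f+c−1, e_c], with the base I and all e_j below f, has c peaks.
-- While the base has at least two entries, s preserves this shape: when the maximum f+c−1 is read
-- it pops everything above the bottom of the stack and settles on it.  Moreover f − 1 reaches the
-- base, not as its first entry, within finitely many steps, and one more step makes it a new peak.
-- On a periodic point the shape then recurs on π itself, so a periodic permutation carries its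
-- largest values n, n−1, … at positions n−1, n−3, … down to a base of one or two entries: it is
-- half-increasing.  Conversely, over a base of at most two entries s merely rotates the non-peak
-- entries I e₁ … e_c, so a half-increasing permutation is periodic.

module Submission where

open import Algebra.Bundles using (CommutativeMonoid)
open import Data.Bool using (Bool; true; false; _∧_; _∨_; not; _xor_; if_then_else_)
open import Data.Bool.ListAction using (any; or)
open import Data.Bool.Properties using (∨-assoc; ∨-identityʳ; ∨-zeroʳ; ∧-zeroʳ; ∨-commutativeMonoid; T-≡)
open import Algebra.Properties.CommutativeSemigroup
  (CommutativeMonoid.commutativeSemigroup ∨-commutativeMonoid) using () renaming (interchange to ∨-interchange)
open import Data.List using (List; []; _∷_; _++_; [_]; map; length; reverse; drop; head; upTo; applyUpTo)
open import Data.List.Properties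
  using (map-∘; ++-assoc; ++-identityʳ; length-++; length-++-≤ˡ; length-map; length-upTo; map-applyUpTo;
         ∷-injective; ∷ʳ-injective; ∷ʳ-injectiveˡ; reverse-++; reverse-involutive)
open import Data.List.Membership.Propositional using (_∈_)
open import Data.List.Membership.Propositional.Properties
  using (∈-∃++; ∈-++⁺ˡ; ∈-++⁺ʳ; ∈-++⁻; ∈-map⁺; ∈-upTo⁺)
open import Data.List.Relation.Binary.Permutation.Propositional
  using (_↭_; ↭-refl; ↭-sym; ↭-trans; ↭-reflexive; ↭⇒↭ₛ)
open import Data.List.Relation.Binary.Permutation.Propositional.Properties
  using (++⁺ˡ; shift; All-resp-↭; ↭-length; ∈-resp-↭)
open import Data.List.Relation.Unary.All as All using (All; []; _∷_)
import Data.List.Relation.Unary.All.Properties as All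
open import Data.List.Relation.Unary.AllPairs using ([]; _∷_)
open import Data.List.Relation.Unary.Any using (here; there)
open import Data.List.Relation.Unary.Unique.Propositional using (Unique)
open import Data.List.Relation.Unary.Unique.Propositional.Properties as Unique using (Unique[x∷xs]⇒x∉xs)
open import Data.Maybe using (Maybe; just)
open import Data.Maybe.Properties using (just-injective)
open import Data.Nat using (ℕ; zero; suc; _+_; _*_; _∸_; _<ᵇ_; _<_; _≤_; z≤n; s≤s)
open import Data.Nat.DivMod using (_/_; _%_; m≡m%n+[m/n]*n; m%n<n)
open import Data.Nat.Properties
open import Data.Product using (_×_; _,_; proj₁; proj₂; ∃; ∃₂; map₂; uncurry)
open import Data.Sum using (_⊎_; inj₁; inj₂)
open import Function using (_∘_; id; Equivalence; _⇔_; mk⇔)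
open import Function.Properties.Equivalence using () renaming (trans to ⇔-trans; sym to ⇔-sym)
open import Relation.Binary using (tri<; tri≈; tri>)
open import Relation.Binary.PropositionalEquality hiding ([_])
open import Relation.Binary.PropositionalEquality.Properties using (setoid)
import Data.List.Relation.Binary.Permutation.Setoid.Properties (setoid ℕ) as PermutationSetoid
open import Relation.Nullary using (contradiction; yes; no)

open import Defs

<ᵇ-true : ∀ {m n} → m < n → (m <ᵇ n) ≡ true
<ᵇ-true m<n = Equivalence.to T-≡ (<⇒<ᵇ m<n)

<ᵇ-false : ∀ {m n} → n ≤ m → (m <ᵇ n) ≡ false
<ᵇ-false {m} {n} n≤m with m <ᵇ n in eq
... | false = refl
... | true  = contradiction (<ᵇ⇒< m n (Equivalence.from T-≡ eq)) (≤⇒≯ n≤m)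

<suc-≢ : ∀ {x g} → x < suc g → x ≢ g → x < g
<suc-≢ x<1+g x≢g = ≤∧≢⇒< (m<1+n⇒m≤n x<1+g) x≢g

All-<suc-≢ : ∀ {g xs} → All (_< suc g) xs → All (_≢ g) xs → All (_< g) xs
All-<suc-≢ below distinct = All.zipWith (uncurry <suc-≢) (below , distinct)

Unique-++⁻ˡ : ∀ {A : Set} (xs : List A) {ys} → Unique (xs ++ ys) → Unique xs
Unique-++⁻ˡ []       _               = []
Unique-++⁻ˡ (x ∷ xs) (x∉ ∷ unique) = All.++⁻ˡ xs x∉ ∷ Unique-++⁻ˡ xs unique

Unique-++⁻ʳ : ∀ {A : Set} (xs : List A) {ys} → Unique (xs ++ ys) → Unique ys
Unique-++⁻ʳ []       unique       = unique
Unique-++⁻ʳ (x ∷ xs) (_ ∷ unique) = Unique-++⁻ʳ xs unique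

Unique-∷ʳ⁻ : ∀ {A : Set} (xs : List A) {b} → Unique (xs ++ [ b ]) → All (_≢ b) xs
Unique-∷ʳ⁻ []       _               = []
Unique-∷ʳ⁻ (x ∷ xs) (x∉ ∷ unique) = All.head (All.++⁻ʳ xs x∉) ∷ Unique-∷ʳ⁻ xs unique

Unique-middle : ∀ {A : Set} (P : List A) {g C} → Unique (P ++ g ∷ C) → All (_≢ g) P × All (_≢ g) C
Unique-middle []      (g∉C ∷ _)      = [] , All.map ≢-sym g∉C
Unique-middle (x ∷ P) (x∉ ∷ unique) =
  All.head (All.++⁻ʳ P x∉) ∷ proj₁ (Unique-middle P unique) , proj₂ (Unique-middle P unique)

Unique-last : ∀ {A : Set} (xs : List A) {M e} → Unique (xs ++ M ∷ e ∷ []) → All (_≢ e) xs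
Unique-last xs {M} {e} unique =
  All.++⁻ˡ xs (Unique-∷ʳ⁻ (xs ++ [ M ]) (subst Unique (sym (++-assoc xs [ M ] [ e ])) unique))

Unique-resp-↭ : ∀ {xs ys : List ℕ} → xs ↭ ys → Unique xs → Unique ys
Unique-resp-↭ p = PermutationSetoid.Unique-resp-↭ (↭⇒↭ₛ p)

iter-suc : ∀ k (f : List ℕ → List ℕ) x → iter k f (f x) ≡ iter (suc k) f x
iter-suc zero    f x = refl
iter-suc (suc k) f x = cong f (iter-suc k f x)

iter-+ : ∀ a b (f : List ℕ → List ℕ) x → iter (a + b) f x ≡ iter a f (iter b f x)
iter-+ zero    b f x = refl
iter-+ (suc a) b f x = cong f (iter-+ a b f x)

iter-* : ∀ q k (f : List ℕ → List ℕ) x → iter k f x ≡ x → iter (q * k) f x ≡ x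
iter-* zero    k f x _   = refl
iter-* (suc q) k f x per = trans (iter-+ k (q * k) f x) (trans (cong (iter k f) (iter-* q k f x per)) per)

-- Subsequences and the push rule of s_{312,321}

any-++ : ∀ {A : Set} (p : A → Bool) xs ys → any p (xs ++ ys) ≡ any p xs ∨ any p ys
any-++ p []       ys = refl
any-++ p (x ∷ xs) ys = trans (cong (p x ∨_) (any-++ p xs ys)) (sym (∨-assoc (p x) _ _))

any-∨ : ∀ {A : Set} (p q : A → Bool) xs → any p xs ∨ any q xs ≡ any (λ y → p y ∨ q y) xs
any-∨ p q []       = refl
any-∨ p q (x ∷ xs) = trans (∨-interchange (p x) _ (q x) _) (cong ((p x ∨ q x) ∨_) (any-∨ p q xs))

any-cong : ∀ {A : Set} {p q : A → Bool} → (∀ y → p y ≡ q y) → ∀ xs → any p xs ≡ any q xs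
any-cong p≗q []       = refl
any-cong p≗q (x ∷ xs) = cong₂ _∨_ (p≗q x) (any-cong p≗q xs)

any-false : ∀ {A : Set} (xs : List A) → any (λ _ → false) xs ≡ false
any-false []       = refl
any-false (x ∷ xs) = any-false xs

any-subseqs-∷ : ∀ (f : List ℕ → Bool) y ys →
  any f (subseqs (y ∷ ys)) ≡ any (λ w → f (y ∷ w)) (subseqs ys) ∨ any f (subseqs ys)
any-subseqs-∷ f y ys =
  trans (any-++ f (map (y ∷_) (subseqs ys)) (subseqs ys))
        (cong (λ b → b ∨ any f (subseqs ys)) (cong or (sym (map-∘ (subseqs ys)))))

onEmpty : Bool → List ℕ → Bool
onEmpty b []      = b
onEmpty b (_ ∷ _) = false

onSingleton : (ℕ → Bool) → List ℕ → Bool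
onSingleton q []      = false
onSingleton q (z ∷ w) = onEmpty (q z) w

onPair : (ℕ → ℕ → Bool) → List ℕ → Bool
onPair p []      = false
onPair p (y ∷ w) = onSingleton (p y) w

anyPair : (ℕ → ℕ → Bool) → List ℕ → Bool
anyPair p []       = false
anyPair p (y ∷ ys) = any (p y) ys ∨ anyPair p ys

any-onEmpty-subseqs : ∀ b ys → any (onEmpty b) (subseqs ys) ≡ b
any-onEmpty-subseqs b []       = ∨-identityʳ b
any-onEmpty-subseqs b (y ∷ ys) =
  trans (any-subseqs-∷ (onEmpty b) y ys)
        (cong₂ _∨_ (any-false (subseqs ys)) (any-onEmpty-subseqs b ys))

any-onSingleton-subseqs : ∀ q ys → any (onSingleton q) (subseqs ys) ≡ any q ys
any-onSingleton-subseqs q []       = refl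
any-onSingleton-subseqs q (y ∷ ys) =
  trans (any-subseqs-∷ (onSingleton q) y ys)
        (cong₂ _∨_ (any-onEmpty-subseqs (q y) ys) (any-onSingleton-subseqs q ys))

any-onPair-subseqs : ∀ p ys → any (onPair p) (subseqs ys) ≡ anyPair p ys
any-onPair-subseqs p []       = refl
any-onPair-subseqs p (y ∷ ys) =
  trans (any-subseqs-∷ (onPair p) y ys)
        (cong₂ _∨_ (any-onSingleton-subseqs (p y) ys) (any-onPair-subseqs p ys))

-- y and z are distinct and both below x, spelled the way orderIso unfolds on 312 and 321.
twoBelow : ℕ → ℕ → ℕ → Bool
twoBelow x y z = not (x <ᵇ y) ∧ (y <ᵇ x) ∧ not (x <ᵇ z) ∧ (z <ᵇ x) ∧ ((y <ᵇ z) xor (z <ᵇ y))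

hasTwoBelow : ℕ → List ℕ → Bool
hasTwoBelow x = anyPair (twoBelow x)

p312 p321 : List ℕ
p312 = 3 ∷ 1 ∷ 2 ∷ []
p321 = 3 ∷ 2 ∷ 1 ∷ []

startsIn : List ℕ → ℕ → List ℕ → Bool
startsIn τ x S = any (orderIso τ ∘ (x ∷_)) (subseqs S)

contains-∷ : ∀ x S τ → contains (x ∷ S) τ ≡ startsIn τ x S ∨ contains S τ
contains-∷ x S τ = any-subseqs-∷ (orderIso τ) x S

orderIso-312∨321 : ∀ x ys → orderIso p312 (x ∷ ys) ∨ orderIso p321 (x ∷ ys) ≡ onPair (twoBelow x) ys
orderIso-312∨321 x []          = refl
orderIso-312∨321 x (y ∷ []) with x <ᵇ y | y <ᵇ x
... | true  | _     = refl
... | false | false = refl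
... | false | true  = refl
orderIso-312∨321 x (y ∷ z ∷ []) with x <ᵇ y | y <ᵇ x | x <ᵇ z | z <ᵇ x | y <ᵇ z | z <ᵇ y
... | true  | _     | _     | _     | _     | _     = refl
... | false | false | _     | _     | _     | _     = refl
... | false | true  | true  | _     | _     | _     = refl
... | false | true  | false | false | _     | _     = refl
... | false | true  | false | true  | true  | true  = refl
... | false | true  | false | true  | true  | false = refl
... | false | true  | false | true  | false | true  = refl
... | false | true  | false | true  | false | false = refl
orderIso-312∨321 x (y ∷ z ∷ _ ∷ _) with x <ᵇ y | y <ᵇ x | x <ᵇ z | z <ᵇ x
... | true  | _     | _     | _     = refl
... | false | false | _     | _     = refl
... | false | true  | true  | _     = refl
... | false | true  | false | false = refl
... | false | true  | false | true  = refl

startsIn-312∨321 : ∀ x S → startsIn p312 x S ∨ startsIn p321 x S ≡ hasTwoBelow x S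
startsIn-312∨321 x S =
  trans (any-∨ _ _ (subseqs S))
        (trans (any-cong (orderIso-312∨321 x) (subseqs S)) (any-onPair-subseqs (twoBelow x) S))

not-∨-interchange : ∀ a b c d → not (a ∨ c) ∧ not (b ∨ d) ∧ true ≡ (not c ∧ not d ∧ true) ∧ not (a ∨ b)
not-∨-interchange true  b     c     d     = sym (∧-zeroʳ _)
not-∨-interchange false true  c     d     = trans (∧-zeroʳ _) (sym (∧-zeroʳ _))
not-∨-interchange false false true  d     = refl
not-∨-interchange false false false true  = refl
not-∨-interchange false false false false = refl

avoids-∷ : ∀ x S → avoidsAll T312-321 (x ∷ S) ≡ avoidsAll T312-321 S ∧ not (hasTwoBelow x S)
avoids-∷ x S rewrite contains-∷ x S p312 | contains-∷ x S p321 | sym (startsIn-312∨321 x S) =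
  not-∨-interchange (startsIn p312 x S) (startsIn p321 x S) (contains S p312) (contains S p321)

-- The stack machine

run : (input stack output : List ℕ) → List ℕ × List ℕ
run []       st       o = st , o
run (x ∷ xs) []       o = run xs [ x ] o
run (x ∷ xs) (t ∷ st) o =
  if hasTwoBelow x (t ∷ st) then run (x ∷ xs) st (o ++ [ t ]) else run xs (x ∷ t ∷ st) o

flush : List ℕ × List ℕ → List ℕ
flush (st , o) = o ++ st

s : List ℕ → List ℕ
s π = flush (run π [] [])

avoids-push : ∀ x S → avoidsAll T312-321 S ≡ true → avoidsAll T312-321 (x ∷ S) ≡ not (hasTwoBelow x S)
avoids-push x S h = trans (avoids-∷ x S) (cong (_∧ not (hasTwoBelow x S)) h)

avoids-tail : ∀ x S → avoidsAll T312-321 (x ∷ S) ≡ true → avoidsAll T312-321 S ≡ true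
avoids-tail x S h with avoidsAll T312-321 S | avoids-∷ x S
... | true  | _ = refl
... | false | e = trans (sym e) h

stackRun≡run : ∀ input st o → avoidsAll T312-321 st ≡ true →
  stackRun T312-321 input st o ≡ flush (run input st o)
stackRun≡run []       st  o  _  = refl
stackRun≡run (x ∷ xs) st₀ o₀ h₀ = onStack st₀ o₀ h₀
  where
  onStack : ∀ st o → avoidsAll T312-321 st ≡ true →
    stackRun T312-321 (x ∷ xs) st o ≡ flush (run (x ∷ xs) st o)
  onStack []       o _ = stackRun≡run xs [ x ] o refl
  onStack (t ∷ st) o h rewrite avoids-push x (t ∷ st) h with hasTwoBelow x (t ∷ st) in blocked
  ... | true  = onStack st (o ++ [ t ]) (avoids-tail t st h)
  ... | false = stackRun≡run xs (x ∷ t ∷ st) o (trans (avoids-push x (t ∷ st) h) (cong not blocked))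

sT≡s : ∀ π → sT T312-321 π ≡ s π
sT≡s π = stackRun≡run π [] [] refl

iter-sT≡iter-s : ∀ k π → iter k (sT T312-321) π ≡ iter k s π
iter-sT≡iter-s zero    π = refl
iter-sT≡iter-s (suc k) π = trans (sT≡s (iter k (sT T312-321) π)) (cong s (iter-sT≡iter-s k π))

Periodic-sT⇔s : ∀ π → Periodic (sT T312-321) π ⇔ Periodic s π
Periodic-sT⇔s π = mk⇔ (λ (k , k>0 , per) → k , k>0 , trans (sym (iter-sT≡iter-s k π)) per)
                      (λ (k , k>0 , per) → k , k>0 , trans (iter-sT≡iter-s k π) per)

run-push : ∀ x xs st o → hasTwoBelow x st ≡ false → run (x ∷ xs) st o ≡ run xs (x ∷ st) o
run-push x xs []       o _ = refl
run-push x xs (t ∷ st) o e rewrite e = refl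

run-pop : ∀ x xs t st o → hasTwoBelow x (t ∷ st) ≡ true →
  run (x ∷ xs) (t ∷ st) o ≡ run (x ∷ xs) st (o ++ [ t ])
run-pop x xs t st o e rewrite e = refl

run-++ : ∀ A B st o → run (A ++ B) st o ≡ uncurry (run B) (run A st o)
run-++ []       B st  o  = refl
run-++ (x ∷ xs) B st₀ o₀ = onStack st₀ o₀
  where
  onStack : ∀ st o → run ((x ∷ xs) ++ B) st o ≡ uncurry (run B) (run (x ∷ xs) st o)
  onStack []       o = run-++ xs B [ x ] o
  onStack (t ∷ st) o with hasTwoBelow x (t ∷ st)
  ... | true  = onStack st (o ++ [ t ])
  ... | false = run-++ xs B (x ∷ t ∷ st) o

run-output : ∀ input st o p → run input st (o ++ p) ≡ map₂ (o ++_) (run input st p)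
run-output []       st  o p  = refl
run-output (x ∷ xs) st₀ o p₀ = onStack st₀ p₀
  where
  onStack : ∀ st p → run (x ∷ xs) st (o ++ p) ≡ map₂ (o ++_) (run (x ∷ xs) st p)
  onStack []       p = run-output xs [ x ] o p
  onStack (t ∷ st) p with hasTwoBelow x (t ∷ st)
  ... | true  rewrite ++-assoc o p [ t ] = onStack st (p ++ [ t ])
  ... | false = run-output xs (x ∷ t ∷ st) o p

run-↭ : ∀ input st o → o ++ st ++ input ↭ flush (run input st o)
run-↭ []       st  o  = ↭-reflexive (cong (o ++_) (++-identityʳ st))
run-↭ (x ∷ xs) st₀ o₀ = onStack st₀ o₀
  where
  onStack : ∀ st o → o ++ st ++ x ∷ xs ↭ flush (run (x ∷ xs) st o)
  onStack []       o = run-↭ xs [ x ] o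
  onStack (t ∷ st) o with hasTwoBelow x (t ∷ st)
  ... | true  = ↭-trans (↭-reflexive (sym (++-assoc o [ t ] (st ++ x ∷ xs)))) (onStack st (o ++ [ t ]))
  ... | false = ↭-trans (++⁺ˡ o (shift x (t ∷ st) xs)) (run-↭ xs (x ∷ t ∷ st) o)

s-↭ : ∀ π → s π ↭ π
s-↭ π = ↭-sym (run-↭ π [] [])

iter-s-↭ : ∀ j π → iter j s π ↭ π
iter-s-↭ zero    π = ↭-refl
iter-s-↭ (suc j) π = ↭-trans (s-↭ (iter j s π)) (iter-s-↭ j π)

twoBelow-aboveʳ : ∀ {x M} y → x ≤ M → twoBelow x y M ≡ false
twoBelow-aboveʳ {x} {M} y x≤M rewrite <ᵇ-false {M} x≤M with x <ᵇ y | y <ᵇ x | x <ᵇ M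
... | true  | _     | _     = refl
... | false | false | _     = refl
... | false | true  | true  = refl
... | false | true  | false = refl

twoBelow-aboveˡ : ∀ {x M} y → x ≤ M → twoBelow x M y ≡ false
twoBelow-aboveˡ {x} {M} y x≤M rewrite <ᵇ-false {M} x≤M with x <ᵇ M
... | true  = refl
... | false = refl

twoBelow-distinct : ∀ {M t b} → t < M → b < M → t ≢ b → twoBelow M t b ≡ true
twoBelow-distinct {M} {t} {b} t<M b<M t≢b
  rewrite <ᵇ-false {M} {t} (<⇒≤ t<M) | <ᵇ-true t<M | <ᵇ-false {M} {b} (<⇒≤ b<M) | <ᵇ-true b<M
  with <-cmp t b
... | tri< t<b _ b≮t rewrite <ᵇ-true t<b | <ᵇ-false {b} {t} (≮⇒≥ b≮t) = refl
... | tri≈ _ t≡b _   = contradiction t≡b t≢b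
... | tri> t≮b _ b<t rewrite <ᵇ-true b<t | <ᵇ-false {t} {b} (≮⇒≥ t≮b) = refl

hasTwoBelow-drop : ∀ {x M} F S → x ≤ M → hasTwoBelow x (S ++ M ∷ F) ≡ hasTwoBelow x (S ++ F)
hasTwoBelow-drop {x} {M} F []      x≤M =
  cong (_∨ hasTwoBelow x F) (trans (any-cong (λ y → twoBelow-aboveˡ y x≤M) F) (any-false F))
hasTwoBelow-drop {x} {M} F (y ∷ S) x≤M = cong₂ _∨_ dropFromAny (hasTwoBelow-drop F S x≤M)
  where
  dropFromAny : any (twoBelow x y) (S ++ M ∷ F) ≡ any (twoBelow x y) (S ++ F)
  dropFromAny rewrite any-++ (twoBelow x y) S (M ∷ F) | any-++ (twoBelow x y) S F
                    | twoBelow-aboveʳ y x≤M = refl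

FloorsAgree : List ℕ → List ℕ → ℕ → Set
FloorsAgree F₁ F₂ x = (∀ S → hasTwoBelow x (S ++ F₁) ≡ hasTwoBelow x (S ++ F₂)) × hasTwoBelow x F₁ ≡ false

-- No letter can pop into the floor, nor tell F₁ from F₂, so the run above the floor is the same.
run-floors : ∀ F₁ F₂ C → All (FloorsAgree F₁ F₂) C → ∀ S o →
  ∃₂ λ S′ o′ → run C (S ++ F₁) o ≡ (S′ ++ F₁ , o′) × run C (S ++ F₂) o ≡ (S′ ++ F₂ , o′)
run-floors F₁ F₂ []       []                         S  o  = S , o , refl , refl
run-floors F₁ F₂ (x ∷ xs) ((agree , onF₁) ∷ agrees) S₀ o₀ = onStack S₀ o₀
  where
  onF₂ : hasTwoBelow x F₂ ≡ false
  onF₂ = trans (sym (agree [])) onF₁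
  onStack : ∀ S o →
    ∃₂ λ S′ o′ → run (x ∷ xs) (S ++ F₁) o ≡ (S′ ++ F₁ , o′) × run (x ∷ xs) (S ++ F₂) o ≡ (S′ ++ F₂ , o′)
  onStack [] o with run-floors F₁ F₂ xs agrees [ x ] o
  ... | S′ , o′ , e₁ , e₂ = S′ , o′ , trans (run-push x xs F₁ o onF₁) e₁ , trans (run-push x xs F₂ o onF₂) e₂
  onStack (t ∷ S) o with hasTwoBelow x (t ∷ S ++ F₁) in blocked
  ... | false with run-floors F₁ F₂ xs agrees (x ∷ t ∷ S) o
  ...   | S′ , o′ , e₁ , e₂ =
          S′ , o′ , e₁ , trans (run-push x xs (t ∷ S ++ F₂) o (trans (sym (agree (t ∷ S))) blocked)) e₂
  onStack (t ∷ S) o | true with onStack S (o ++ [ t ])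
  ...   | S′ , o′ , e₁ , e₂ =
          S′ , o′ , e₁ , trans (run-pop x xs t (S ++ F₂) o (trans (sym (agree (t ∷ S))) blocked)) e₂

s-max-∷ : ∀ M σ → All (_< M) σ → s (M ∷ σ) ≡ s σ ++ [ M ]
s-max-∷ M σ σ<M with run-floors [ M ] [] σ (All.map (λ x<M → (λ S → hasTwoBelow-drop [] S (<⇒≤ x<M)) , refl) σ<M) [] []
... | S′ , o′ , e₁ , e₂ = begin
  flush (run σ [ M ] [])       ≡⟨ cong flush e₁ ⟩
  o′ ++ S′ ++ [ M ]            ≡⟨ sym (++-assoc o′ S′ [ M ]) ⟩
  (o′ ++ S′) ++ [ M ]          ≡⟨ cong (λ z → (o′ ++ z) ++ [ M ]) (sym (++-identityʳ S′)) ⟩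
  (o′ ++ S′ ++ []) ++ [ M ]    ≡⟨ cong (λ z → flush z ++ [ M ]) (sym e₂) ⟩
  flush (run σ [] []) ++ [ M ] ∎
  where open ≡-Reasoning

run-popTo : ∀ M C SA b o → b < M → All (λ t → t < M × t ≢ b) SA →
  run (M ∷ C) (SA ++ [ b ]) o ≡ run C (M ∷ b ∷ []) (o ++ SA)
run-popTo M C []       b o _   []                      = cong (run C (M ∷ b ∷ [])) (sym (++-identityʳ o))
run-popTo M C (t ∷ SA) b o b<M ((t<M , t≢b) ∷ others) = begin
  run (M ∷ C) (t ∷ SA ++ [ b ]) o       ≡⟨ run-pop M C t (SA ++ [ b ]) o blocked ⟩
  run (M ∷ C) (SA ++ [ b ]) (o ++ [ t ]) ≡⟨ run-popTo M C SA b (o ++ [ t ]) b<M others ⟩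
  run C (M ∷ b ∷ []) ((o ++ [ t ]) ++ SA) ≡⟨ cong (run C (M ∷ b ∷ [])) (++-assoc o [ t ] SA) ⟩
  run C (M ∷ b ∷ []) (o ++ t ∷ SA)      ∎
  where
  open ≡-Reasoning
  blocked : hasTwoBelow M (t ∷ SA ++ [ b ]) ≡ true
  blocked rewrite any-++ (twoBelow M t) SA [ b ] | twoBelow-distinct t<M b<M t≢b
                | ∨-zeroʳ (any (twoBelow M t) SA) = refl

-- When the maximum M arrives, b is at the bottom of the stack and everything above it is popped;
-- afterwards the pair M, b acts on C as b alone does.
s-split : ∀ b A M C → All (_< M) (b ∷ A) → Unique (b ∷ A) → All (_< M) C →
  ∃₂ λ X Y → s (b ∷ A) ≡ X ++ [ b ] × s (b ∷ C) ≡ Y ++ [ b ] × s ((b ∷ A) ++ M ∷ C) ≡ X ++ Y ++ M ∷ b ∷ []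
s-split b A M C (b<M ∷ A<M) uniqueA C<M
  with run-floors [ b ] [ b ] A (All.universal (λ _ → (λ _ → refl) , refl) A) [] []
     | run-floors (M ∷ b ∷ []) [ b ] C (All.map (λ x<M → (λ S → hasTwoBelow-drop [ b ] S (<⇒≤ x<M))
                                                     , hasTwoBelow-drop [ b ] [] (<⇒≤ x<M)) C<M) [] []
... | SA , oA , eA , _ | SC , oC , eC₁ , eC₂ =
  oA ++ SA , oC ++ SC , trans (cong flush eA) (sym (++-assoc oA SA [ b ]))
  , trans (cong flush eC₂) (sym (++-assoc oC SC [ b ])) , sMerged
  where
  open ≡-Reasoning
  sA↭ : b ∷ A ↭ oA ++ SA ++ [ b ]
  sA↭ = subst (λ r → b ∷ A ↭ flush r) eA (run-↭ A [ b ] [])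
  SA-below : All (λ t → t < M × t ≢ b) SA
  SA-below = All.zip ( All.++⁻ˡ SA (All.++⁻ʳ oA (All-resp-↭ sA↭ (b<M ∷ A<M)))
                     , Unique-∷ʳ⁻ SA (Unique-++⁻ʳ oA (Unique-resp-↭ sA↭ uniqueA)))
  sMerged : s ((b ∷ A) ++ M ∷ C) ≡ (oA ++ SA) ++ (oC ++ SC) ++ M ∷ b ∷ []
  sMerged = begin
    flush (run ((b ∷ A) ++ M ∷ C) [] [])          ≡⟨ cong flush (run-++ (b ∷ A) (M ∷ C) [] []) ⟩
    flush (uncurry (run (M ∷ C)) (run A [ b ] [])) ≡⟨ cong (flush ∘ uncurry (run (M ∷ C))) eA ⟩
    flush (run (M ∷ C) (SA ++ [ b ]) oA)          ≡⟨ cong flush (run-popTo M C SA b oA b<M SA-below) ⟩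
    flush (run C (M ∷ b ∷ []) (oA ++ SA))         ≡⟨ cong (flush ∘ run C (M ∷ b ∷ [])) (sym (++-identityʳ _)) ⟩
    flush (run C (M ∷ b ∷ []) ((oA ++ SA) ++ [])) ≡⟨ cong flush (run-output C (M ∷ b ∷ []) (oA ++ SA) []) ⟩
    flush (map₂ ((oA ++ SA) ++_) (run C (M ∷ b ∷ []) [])) ≡⟨ cong (flush ∘ map₂ ((oA ++ SA) ++_)) eC₁ ⟩
    ((oA ++ SA) ++ oC) ++ SC ++ M ∷ b ∷ []        ≡⟨ ++-assoc (oA ++ SA) oC _ ⟩
    (oA ++ SA) ++ oC ++ SC ++ M ∷ b ∷ []          ≡⟨ cong ((oA ++ SA) ++_) (sym (++-assoc oC SC _)) ⟩
    (oA ++ SA) ++ (oC ++ SC) ++ M ∷ b ∷ []        ∎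

-- Peaks c f I π: π = I ++ [f, e₁, f+1, e₂, …, f+c−1, e_c] where I and all e_j lie below f.
data Peaks : ℕ → ℕ → List ℕ → List ℕ → Set where
  base : ∀ {f I} → All (_< f) I → Peaks 0 f I I
  peak : ∀ {c f I A M e} → Peaks c f I A → e < f → M ≡ c + f → Peaks (suc c) f I (A ++ M ∷ e ∷ [])

Peaks-prefix : ∀ {c f I π} → Peaks c f I π → ∃ λ T → π ≡ I ++ T
Peaks-prefix (base _) = [] , sym (++-identityʳ _)
Peaks-prefix (peak {I = I} {M = M} {e} L _ _) with Peaks-prefix L
... | T , refl = T ++ M ∷ e ∷ [] , ++-assoc I T (M ∷ e ∷ [])

Peaks-base-below : ∀ {c f I π} → Peaks c f I π → All (_< f) I
Peaks-base-below (base I<f)   = I<f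
Peaks-base-below (peak L _ _) = Peaks-base-below L

Peaks-bound : ∀ {c f I π} → Peaks c f I π → All (_< c + f) π
Peaks-bound (base I<f) = I<f
Peaks-bound {suc c} {f} (peak L e<f refl) =
  All.++⁺ (All.map (λ x<M → ≤-trans x<M (n≤1+n _)) (Peaks-bound L)) (≤-refl ∷ <-≤-trans e<f (m≤n+m f (suc c)) ∷ [])

Peaks-length : ∀ {c f I π} → Peaks c f I π → length π ≡ c + c + length I
Peaks-length (base _) = refl
Peaks-length {suc c} {I = I} (peak {A = A} {M} {e} L _ _) = begin
  length (A ++ M ∷ e ∷ [])        ≡⟨ length-++ A ⟩
  length A + 2                    ≡⟨ cong (_+ 2) (Peaks-length L) ⟩
  c + c + length I + 2            ≡⟨ +-comm _ 2 ⟩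
  suc (suc (c + c + length I))    ≡⟨ cong (λ k → suc (k + length I)) (sym (+-suc c c)) ⟩
  suc c + suc c + length I        ∎
  where open ≡-Reasoning

Peaks-Unique-base : ∀ {c f I π} → Peaks c f I π → Unique π → Unique I
Peaks-Unique-base L unique with Peaks-prefix L
... | T , refl = Unique-++⁻ˡ _ unique

Peaks-∈-base : ∀ {c f I π g} → Peaks c f I π → g ∈ I → g ∈ π
Peaks-∈-base L g∈I with Peaks-prefix L
... | T , refl = ∈-++⁺ˡ g∈I

-- The last entry of π is not a peak, so it may be replaced by any value below f.
Peaks-replaceLast : ∀ {c f J π} → Peaks c f J π → ∀ X b e → π ≡ X ++ [ b ] → e < f →
  ∃ λ J′ → Peaks c f J′ (X ++ [ e ]) × length J′ ≡ length J
         × (c ≡ 0 → J′ ≡ X ++ [ e ]) × (0 < c → J′ ≡ J)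
Peaks-replaceLast (base J<f) X b e refl e<f =
  X ++ [ e ] , base (All.++⁺ (All.++⁻ˡ X J<f) (e<f ∷ [])) , trans (length-++ X) (sym (length-++ X))
  , (λ _ → refl) , (λ ())
Peaks-replaceLast {J = J} (peak {A = A} {M} {e₀} L e₀<f M≡) X b e π≡ e<f =
  J , subst (Peaks _ _ _) A-e≡X-e (peak L e<f M≡) , refl , (λ ()) , (λ _ → refl)
  where
  AM≡X : A ++ [ M ] ≡ X
  AM≡X = ∷ʳ-injectiveˡ (A ++ [ M ]) X (trans (++-assoc A [ M ] [ e₀ ]) π≡)
  A-e≡X-e : A ++ M ∷ e ∷ [] ≡ X ++ [ e ]
  A-e≡X-e = trans (sym (++-assoc A [ M ] [ e ])) (cong (_++ [ e ]) AM≡X)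

s-++-peak : ∀ {c f b I A} M e → Peaks c f (b ∷ I) A → e < f → M ≡ c + f → Unique (A ++ M ∷ e ∷ []) →
  ∃ λ X → s A ≡ X ++ [ b ] × s (A ++ M ∷ e ∷ []) ≡ (X ++ [ e ]) ++ M ∷ b ∷ []
s-++-peak {c} {f} {b} {I} {A} M e L e<f M≡ unique with Peaks-prefix L
... | T , A≡
  with s-split b (I ++ T) M [ e ] (subst (All (_< M)) A≡ (subst (λ k → All (_< k) A) (sym M≡) (Peaks-bound L)))
               (subst Unique A≡ (Unique-++⁻ˡ A unique)) (subst (e <_) (sym M≡) (<-≤-trans e<f (m≤n+m f c)) ∷ [])
... | X , Y , sA , se , sπ = X , trans (cong s A≡) sA , sAMe
  where
  open ≡-Reasoning
  Y≡ : Y ≡ [ e ]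
  Y≡ = ∷ʳ-injectiveˡ Y [ e ] (sym se)
  sAMe : s (A ++ M ∷ e ∷ []) ≡ (X ++ [ e ]) ++ M ∷ b ∷ []
  sAMe = begin
    s (A ++ M ∷ e ∷ [])                  ≡⟨ cong (λ z → s (z ++ M ∷ e ∷ [])) A≡ ⟩
    s ((b ∷ I ++ T) ++ M ∷ e ∷ [])        ≡⟨ sπ ⟩
    X ++ Y ++ M ∷ b ∷ []                 ≡⟨ cong (λ z → X ++ z ++ M ∷ b ∷ []) Y≡ ⟩
    X ++ [ e ] ++ M ∷ b ∷ []             ≡⟨ sym (++-assoc X [ e ] _) ⟩
    (X ++ [ e ]) ++ M ∷ b ∷ []           ∎

Peaks-s-++-peak : ∀ {c f b I J A M e X} → Peaks c f (b ∷ I) A → e < f → M ≡ c + f →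
  s A ≡ X ++ [ b ] → s (A ++ M ∷ e ∷ []) ≡ (X ++ [ e ]) ++ M ∷ b ∷ [] → Peaks c f J (s A) →
  ∃ λ J′ → Peaks (suc c) f J′ (s (A ++ M ∷ e ∷ [])) × length J′ ≡ length J
         × (c ≡ 0 → J′ ≡ X ++ [ e ]) × (0 < c → J′ ≡ J)
Peaks-s-++-peak {X = X} L e<f M≡ sA sπ LsA with Peaks-replaceLast LsA X _ _ sA e<f
... | J′ , LJ′ , |J′| , c≡0 , 0<c = J′ , subst (Peaks _ _ _) (sym sπ) (peak LJ′ (All.head (Peaks-base-below L)) M≡) , |J′| , c≡0 , 0<c

s-Peaks : ∀ {c f I π} → Peaks c f I π → Unique π → 1 ≤ length I →
  ∃ λ I′ → Peaks c f I′ (s π) × length I′ ≡ length I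
s-Peaks {I = I} (base I<f) _ _ = s I , base (All-resp-↭ (↭-sym (s-↭ I)) I<f) , ↭-length (s-↭ I)
s-Peaks {suc c} {f} {b ∷ I} (peak {A = A} {M} {e} L e<f M≡) unique _
  with s-++-peak M e L e<f M≡ unique
... | X , sA , sπ with s-Peaks L (Unique-++⁻ˡ A unique) (s≤s z≤n)
... | J , LJ , |J| with Peaks-s-++-peak L e<f M≡ sA sπ LJ
... | J′ , LJ′ , |J′| , _ = J′ , LJ′ , trans |J′| |J|

iter-s-Peaks : ∀ j {c f I π} → Peaks c f I π → Unique π → 1 ≤ length I →
  ∃ λ I′ → Peaks c f I′ (iter j s π) × length I′ ≡ length I
iter-s-Peaks zero    L _ _ = _ , L , refl
iter-s-Peaks (suc j) {π = π} L unique |I|≥1 with iter-s-Peaks j L unique |I|≥1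
... | I′ , L′ , |I′| with s-Peaks L′ (Unique-resp-↭ (↭-sym (iter-s-↭ j π)) unique) (subst (1 ≤_) (sym |I′|) |I|≥1)
... | I″ , L″ , |I″| = I″ , L″ , trans |I″| |I′|

InTail : List ℕ → ℕ → Set
InTail I g = ∃₂ λ b I′ → I ≡ b ∷ I′ × g ∈ I′

s-Peaks-climb : ∀ {c g I π} → Peaks c (suc g) I π → Unique π → InTail I g →
  ∃ λ J → Peaks (suc c) g J (s π) × length J + 2 ≡ length I
s-Peaks-climb {zero} {g} (base (b<g+1 ∷ PgC<g+1)) unique (b , _ , refl , g∈I′) with ∈-∃++ g∈I′
... | P , C , refl
  with Unique-middle (b ∷ P) unique
... | b≢g ∷ P≢g , C≢g
  with s-split b P g C (All-<suc-≢ (b<g+1 ∷ All.++⁻ˡ P PgC<g+1) (b≢g ∷ P≢g)) (Unique-++⁻ˡ (b ∷ P) unique)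
                       (All-<suc-≢ (All.tail (All.++⁻ʳ P PgC<g+1)) C≢g)
... | X , Y , _ , _ , sπ = X ++ Y , subst (Peaks _ _ _) (sym sπ′) (peak (base XY<g) (<suc-≢ b<g+1 b≢g) refl) , |XY|
  where
  π : List ℕ
  π = b ∷ P ++ g ∷ C
  sπ′ : s π ≡ (X ++ Y) ++ g ∷ b ∷ []
  sπ′ = trans sπ (sym (++-assoc X Y _))
  sπ↭ : (X ++ Y) ++ g ∷ b ∷ [] ↭ π
  sπ↭ = subst (_↭ π) sπ′ (s-↭ π)
  XY<g : All (_< g) (X ++ Y)
  XY<g = All-<suc-≢ (All.++⁻ˡ (X ++ Y) (All-resp-↭ (↭-sym sπ↭) (b<g+1 ∷ PgC<g+1)))
                   (proj₁ (Unique-middle (X ++ Y) (Unique-resp-↭ (↭-sym sπ↭) unique)))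
  |XY| : length (X ++ Y) + 2 ≡ length π
  |XY| = trans (sym (length-++ (X ++ Y))) (↭-length sπ↭)
s-Peaks-climb {suc c} {g} (peak {A = A} {M} {e} L e<g+1 M≡) unique (b , I′ , refl , g∈I′)
  with s-++-peak M e L e<g+1 M≡ unique
... | X , sA , sπ with s-Peaks-climb L (Unique-++⁻ˡ A unique) (b , I′ , refl , g∈I′)
... | J , LJ , |J| with Peaks-replaceLast LJ X b e sA (<suc-≢ e<g+1 e≢g)
  where
  e≢g : e ≢ g
  e≢g refl = All.lookup (Unique-last A unique) (Peaks-∈-base L (there g∈I′)) refl
... | J′ , LJ′ , |J′| , _ =
  J′ , subst (Peaks _ _ _) (sym sπ) (peak LJ′ b<g (trans M≡ (+-suc c g))) , trans (cong (_+ 2) |J′|) |J|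
  where
  b<g : b < g
  b<g = <suc-≢ (All.head (Peaks-base-below L)) (λ { refl → Unique[x∷xs]⇒x∉xs (Peaks-Unique-base L (Unique-++⁻ˡ A unique)) g∈I′ })

-- Periodic points gain peaks

twice : ℕ → ℕ
twice zero    = zero
twice (suc k) = suc (suc (twice k))

fromEnd : List ℕ → ℕ → Maybe ℕ
fromEnd π k = head (drop k (reverse π))

fromEnd-∷ʳ-zero : ∀ X y → fromEnd (X ++ [ y ]) 0 ≡ just y
fromEnd-∷ʳ-zero X y rewrite reverse-++ X [ y ] = refl

fromEnd-∷ʳ-suc : ∀ X y k → fromEnd (X ++ [ y ]) (suc k) ≡ fromEnd X k
fromEnd-∷ʳ-suc X y k rewrite reverse-++ X [ y ] = refl

fromEnd-peak-zero : ∀ A M e → fromEnd (A ++ M ∷ e ∷ []) 0 ≡ just e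
fromEnd-peak-zero A M e rewrite reverse-++ A (M ∷ e ∷ []) = refl

fromEnd-peak-suc : ∀ A M e k → fromEnd (A ++ M ∷ e ∷ []) (suc (suc k)) ≡ fromEnd A k
fromEnd-peak-suc A M e k rewrite reverse-++ A (M ∷ e ∷ []) = refl

fromEnd-twice-∸ : ∀ {d c} π → d < c → fromEnd π (twice (c ∸ d)) ≡ fromEnd π (suc (suc (twice (c ∸ suc d))))
fromEnd-twice-∸ π d<c = cong (fromEnd π ∘ twice) (+-∸-assoc 1 d<c)

HeadOf : List ℕ → ℕ → Set
HeadOf I g = ∃ λ I′ → I ≡ g ∷ I′

-- Arrival c I π g d: in Peaks c f I π, the value g gets into the tail of the base after d steps:
-- it is in the tail already (d = 0), it is e_d (0 < d ≤ c), or it heads the base (d = c + 1).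
Arrival : ℕ → List ℕ → List ℕ → ℕ → ℕ → Set
Arrival c I π g zero    = InTail I g
Arrival c I π g (suc d) = (d ≡ c × HeadOf I g) ⊎ (d < c × fromEnd π (twice (c ∸ suc d)) ≡ just g)

Arrival-peak : ∀ {c I A g} M e d → Arrival c I A g d → ∃ λ d′ → Arrival (suc c) I (A ++ M ∷ e ∷ []) g d′
Arrival-peak M e zero    inTail            = zero , inTail
Arrival-peak M e (suc d) (inj₁ (refl , h)) = suc (suc d) , inj₁ (refl , h)
Arrival-peak {c} {I} {A} {g} M e (suc d) (inj₂ (d<c , g-at)) = suc d , inj₂ (m<n⇒m<1+n d<c , g-at′)
  where
  g-at′ : fromEnd (A ++ M ∷ e ∷ []) (twice (suc c ∸ suc d)) ≡ just g
  g-at′ rewrite fromEnd-twice-∸ (A ++ M ∷ e ∷ []) d<c | fromEnd-peak-suc A M e (twice (c ∸ suc d)) = g-at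

Arrival-exists : ∀ {c g I π} → Peaks c (suc g) I π → g ∈ π → ∃ λ d → Arrival c I π g d
Arrival-exists {zero}          (base _) (here refl) = 1 , inj₁ (refl , _ , refl)
Arrival-exists {zero} {I = b ∷ I′} (base _) (there g∈I′) = 0 , b , I′ , refl , g∈I′
Arrival-exists {suc c} {g} (peak {A = A} {M} {e} L _ refl) g∈π with ∈-++⁻ A g∈π
... | inj₁ g∈A = let d , arrival = Arrival-exists L g∈A in Arrival-peak M e d arrival
... | inj₂ (here g≡M) = contradiction g≡M (<⇒≢ (subst (g <_) (sym (+-suc c g)) (s≤s (m≤n+m g c))))
... | inj₂ (there (here refl)) = suc c , inj₂ (≤-refl , e-last)
  where
  e-last : fromEnd (A ++ M ∷ e ∷ []) (twice (suc c ∸ suc c)) ≡ just e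
  e-last rewrite n∸n≡0 c = fromEnd-peak-zero A M e

InTail-∷ʳ : ∀ X {e g} → 1 ≤ length X → e ≡ g → InTail (X ++ [ e ]) g
InTail-∷ʳ (x ∷ X′) _ refl = x , X′ ++ [ _ ] , refl , ∈-++⁺ʳ X′ (here refl)

Arrival-shift : ∀ {c I g d M} X b e → d < c →
  Arrival c I (X ++ [ b ]) g d → Arrival (suc c) I ((X ++ [ e ]) ++ M ∷ b ∷ []) g d
Arrival-shift {d = zero}  X b e _     inTail             = inTail
Arrival-shift {c} {d = suc _} _ _ _ 1+d<c (inj₁ (refl , _)) = contradiction 1+d<c (<-asym (n<1+n c))
Arrival-shift {c} {I} {g} {suc d} {M} X b e 1+d<c (inj₂ (d<c , g-at)) = inj₂ (m<n⇒m<1+n d<c , g-at′)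
  where
  k : ℕ
  k = suc (twice (c ∸ suc (suc d)))
  g-at′ : fromEnd ((X ++ [ e ]) ++ M ∷ b ∷ []) (twice (suc c ∸ suc d)) ≡ just g
  g-at′ rewrite fromEnd-twice-∸ ((X ++ [ e ]) ++ M ∷ b ∷ []) d<c | fromEnd-peak-suc (X ++ [ e ]) M b (twice (c ∸ suc d))
              | fromEnd-twice-∸ (X ++ [ e ]) 1+d<c | fromEnd-∷ʳ-suc X e k
              = trans (sym (fromEnd-∷ʳ-suc X b k)) (trans (sym (fromEnd-twice-∸ (X ++ [ b ]) 1+d<c)) g-at)

Arrival-lastEntry : ∀ c {J X M b g} e → 2 ≤ length J → (c ≡ 0 → J ≡ X ++ [ e ]) → e ≡ g →
  Arrival (suc c) J ((X ++ [ e ]) ++ M ∷ b ∷ []) g c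
Arrival-lastEntry zero {X = X} e |J|≥2 J≡ e≡g rewrite J≡ refl = InTail-∷ʳ X |X|≥1 e≡g
  where
  |X|≥1 : 1 ≤ length X
  |X|≥1 = ≤-pred (subst (2 ≤_) (trans (length-++ X) (+-comm (length X) 1)) |J|≥2)
Arrival-lastEntry (suc c) {X = X} {M} {b} e _ _ e≡g = inj₂ (m<n⇒m<1+n (n<1+n c) , e-at)
  where
  e-at : fromEnd ((X ++ [ e ]) ++ M ∷ b ∷ []) (twice (suc (suc c) ∸ suc c)) ≡ just _
  e-at rewrite m+n∸n≡m 1 c | fromEnd-peak-suc (X ++ [ e ]) M b 0 | fromEnd-∷ʳ-zero X e = cong just e≡g

s-Arrival-head : ∀ {g I′} → All (_< suc g) (g ∷ I′) → Unique (g ∷ I′) → 1 ≤ length I′ →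
  ∃ λ I″ → Peaks 0 (suc g) I″ (s (g ∷ I′)) × length I″ ≡ suc (length I′) × InTail I″ g
s-Arrival-head {g} {I′} I<g+1 (g∉I′ ∷ _) |I′|≥1
  with s I′ | s-max-∷ g I′ (All-<suc-≢ (All.tail I<g+1) (All.map ≢-sym g∉I′)) | ↭-length (s-↭ I′)
... | []    | _  | |sI′| = contradiction (subst (1 ≤_) (sym |sI′|) |I′|≥1) λ ()
... | y ∷ Z | sπ | _     =
  s (g ∷ I′) , base (All-resp-↭ (↭-sym (s-↭ (g ∷ I′))) I<g+1) , ↭-length (s-↭ (g ∷ I′))
  , y , Z ++ [ g ] , sπ , ∈-++⁺ʳ Z (here refl)

s-Arrival : ∀ {c g I π d} → Peaks c (suc g) I π → Unique π → 2 ≤ length I → Arrival c I π g (suc d) →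
  ∃ λ I′ → Peaks c (suc g) I′ (s π) × length I′ ≡ length I × Arrival c I′ (s π) g d
s-Arrival {zero} (base I<g+1) unique (s≤s |I′|≥1) (inj₁ (refl , I′ , refl)) = s-Arrival-head I<g+1 unique |I′|≥1
s-Arrival {zero} (base _) _ _ (inj₂ (() , _))
s-Arrival {suc c} {g} {b ∷ I} {d = d} (peak {A = A} {M} {e} L e<f M≡) unique |I|≥2 arrival
  with s-++-peak M e L e<f M≡ unique | arrival
... | X , sA , sπ | inj₂ (d<1+c , g-at) with m<1+n⇒m<n∨m≡n d<1+c
...   | inj₁ d<c with s-Arrival L (Unique-++⁻ˡ A unique) |I|≥2 (inj₂ (d<c , g-atA))
  where
  g-atA : fromEnd A (twice (c ∸ suc d)) ≡ just g
  g-atA = trans (sym (fromEnd-peak-suc A M e (twice (c ∸ suc d))))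
                (trans (sym (fromEnd-twice-∸ (A ++ M ∷ e ∷ []) d<c)) g-at)
...     | I″ , LI″ , |I″| , arrivalA with Peaks-s-++-peak L e<f M≡ sA sπ LI″
...       | J′ , LJ′ , |J′| , _ , J′≡ =
  J′ , LJ′ , trans |J′| |I″| ,
  subst (λ σ → Arrival (suc c) J′ σ g d) (sym sπ)
        (Arrival-shift X b e d<c (subst₂ (λ J σ → Arrival c J σ g d) (sym (J′≡ (≤-trans (s≤s z≤n) d<c))) sA arrivalA))
s-Arrival {suc c} {g} {b ∷ I} (peak {A = A} {M} {e} L e<f M≡) unique |I|≥2 _
  | X , sA , sπ | inj₂ (_ , g-at) | inj₂ refl with s-Peaks L (Unique-++⁻ˡ A unique) (s≤s z≤n)
...   | J , LJ , |J| with Peaks-s-++-peak L e<f M≡ sA sπ LJ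
...     | J′ , LJ′ , |J′| , J′≡ , _ =
  J′ , LJ′ , trans |J′| |J| ,
  subst (λ σ → Arrival (suc c) J′ σ g c) (sym sπ)
        (Arrival-lastEntry c e (subst (2 ≤_) (sym (trans |J′| |J|)) |I|≥2) J′≡ e≡g)
  where
  e≡g : e ≡ g
  e≡g = just-injective (trans (sym (fromEnd-peak-zero A M e))
                              (subst (λ k → fromEnd (A ++ M ∷ e ∷ []) (twice k) ≡ just g) (n∸n≡0 c) g-at))
s-Arrival {suc c} {g} {b ∷ I} (peak {A = A} {M} {e} L e<f M≡) unique _ _
  | X , sA , sπ | inj₁ (refl , _ , refl) with s-Peaks L (Unique-++⁻ˡ A unique) (s≤s z≤n)
...   | J , LJ , |J| with Peaks-s-++-peak L e<f M≡ sA sπ LJ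
...     | J′ , LJ′ , |J′| , _ = J′ , LJ′ , trans |J′| |J| , inj₂ (≤-refl , b-last)
  where
  b-last : fromEnd (s (A ++ M ∷ e ∷ [])) (twice (suc c ∸ suc c)) ≡ just b
  b-last rewrite n∸n≡0 c | sπ = fromEnd-peak-zero (X ++ [ e ]) M b

iter-s-climb : ∀ d {c g I π} → Peaks c (suc g) I π → Unique π → 2 ≤ length I → Arrival c I π g d →
  ∃ λ J → Peaks (suc c) g J (iter (suc d) s π) × length J + 2 ≡ length I
iter-s-climb zero    L unique _     inTail = s-Peaks-climb L unique inTail
iter-s-climb (suc d) {π = π} L unique |I|≥2 arrival with s-Arrival L unique |I|≥2 arrival
... | I′ , L′ , |I′| , arrival′
  with iter-s-climb d L′ (Unique-resp-↭ (↭-sym (s-↭ π)) unique) (subst (2 ≤_) (sym |I′|) |I|≥2) arrival′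
... | J , LJ , |J| = J , subst (Peaks _ _ _) (iter-suc (suc d) s π) LJ , trans |J| |I′|

-- On a periodic point the shape reached after d + 1 steps comes back to π itself.
Periodic-climb : ∀ k {c g I π} → 0 < k → iter k s π ≡ π → Peaks c (suc g) I π → Unique π →
  3 ≤ length I → g ∈ π → ∃ λ J → Peaks (suc c) g J π × length J + 2 ≡ length I
Periodic-climb (suc k) {π = π} _ per L unique |I|≥3 g∈π with Arrival-exists L g∈π
... | d , arrival with iter-s-climb d L unique (≤-trans (n≤1+n 2) |I|≥3) arrival
... | J , LJ , |J|
  with iter-s-Peaks (k * suc d) LJ (Unique-resp-↭ (↭-sym (iter-s-↭ (suc d) π)) unique) (|J|≥1 (length J) |J| |I|≥3)
  where
  |J|≥1 : ∀ a {b} → a + 2 ≡ b → 3 ≤ b → 1 ≤ a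
  |J|≥1 zero    refl (s≤s (s≤s ()))
  |J|≥1 (suc a) _    _ = s≤s z≤n
... | J′ , LJ′ , |J′| = J′ , subst (Peaks _ _ _) back LJ′ , trans (cong (_+ 2) |J′|) |J|
  where
  back : iter (k * suc d) s (iter (suc d) s π) ≡ π
  back = begin
    iter (k * suc d) s (iter (suc d) s π) ≡⟨ sym (iter-+ (k * suc d) (suc d) s π) ⟩
    iter (k * suc d + suc d) s π          ≡⟨ cong (λ n → iter n s π) (+-comm (k * suc d) (suc d)) ⟩
    iter (suc k * suc d) s π              ≡⟨ cong (λ n → iter n s π) (*-comm (suc k) (suc d)) ⟩
    iter (suc d * suc k) s π              ≡⟨ iter-* (suc d) (suc k) s π per ⟩
    π                                     ∎
    where open ≡-Reasoning

-- A base of at most two entries gives a periodic point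

freeRev : ℕ → List ℕ → List ℕ
freeRev zero    r           = reverse r
freeRev (suc c) (e ∷ _ ∷ r) = freeRev c r ++ [ e ]
freeRev (suc c) _           = []

-- For Peaks c f I π this is I ++ [e₁, …, e_c], the entries of π other than its c peaks.
free : ℕ → List ℕ → List ℕ
free c π = freeRev c (reverse π)

free-zero : ∀ π → free 0 π ≡ π
free-zero = reverse-involutive

free-peak : ∀ c A M e → free (suc c) (A ++ M ∷ e ∷ []) ≡ free c A ++ [ e ]
free-peak c A M e rewrite reverse-++ A (M ∷ e ∷ []) = refl

Peaks-free : ∀ {c f I π} → Peaks c f I π → ∃ λ E → free c π ≡ I ++ E
Peaks-free {π = π} (base _) = [] , trans (free-zero π) (sym (++-identityʳ π))
Peaks-free {suc c} {I = I} (peak {A = A} {M} {e} L _ _) with Peaks-free L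
... | E , freeA = E ++ [ e ] , trans (free-peak c A M e) (trans (cong (_++ [ e ]) freeA) (++-assoc I E [ e ]))

Peaks-free-injective : ∀ {c f I I′ π π′} → Peaks c f I π → Peaks c f I′ π′ → free c π ≡ free c π′ → π ≡ π′
Peaks-free-injective {π = π} {π′} (base _) (base _) eq = trans (sym (free-zero π)) (trans eq (free-zero π′))
Peaks-free-injective {suc c} (peak {A = A} {M} {e} L _ refl) (peak {A = A′} {M′} {e′} L′ _ refl) eq
  with ∷ʳ-injective (free c A) (free c A′) (trans (sym (free-peak c A M e)) (trans eq (free-peak c A′ M′ e′)))
... | freeA≡ , refl with Peaks-free-injective L L′ freeA≡
... | refl = refl

free-replaceLast : ∀ {c f J π} → Peaks c f J π → ∀ X b e → π ≡ X ++ [ b ] →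
  ∃ λ G → free c (X ++ [ b ]) ≡ G ++ [ b ] × free c (X ++ [ e ]) ≡ G ++ [ e ]
free-replaceLast {zero} (base _) X b e _ = X , free-zero _ , free-zero _
free-replaceLast {suc c} (peak {A = A} {M} {e₀} L _ _) X b e π≡ =
  free c A , trans (cong (free (suc c)) (sym (A-y≡X-y b))) (free-peak c A M b)
           , trans (cong (free (suc c)) (sym (A-y≡X-y e))) (free-peak c A M e)
  where
  AM≡X : A ++ [ M ] ≡ X
  AM≡X = ∷ʳ-injectiveˡ (A ++ [ M ]) X (trans (++-assoc A [ M ] [ e₀ ]) π≡)
  A-y≡X-y : ∀ y → A ++ M ∷ y ∷ [] ≡ X ++ [ y ]
  A-y≡X-y y = trans (sym (++-assoc A [ M ] [ y ])) (cong (_++ [ y ]) AM≡X)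

rotate : List ℕ → List ℕ
rotate []       = []
rotate (x ∷ xs) = xs ++ [ x ]

iter-rotate-++ : ∀ xs ys → iter (length xs) rotate (xs ++ ys) ≡ ys ++ xs
iter-rotate-++ []       ys = sym (++-identityʳ ys)
iter-rotate-++ (x ∷ xs) ys = begin
  iter (suc (length xs)) rotate (x ∷ xs ++ ys)  ≡⟨ sym (iter-suc (length xs) rotate (x ∷ xs ++ ys)) ⟩
  iter (length xs) rotate ((xs ++ ys) ++ [ x ]) ≡⟨ cong (iter (length xs) rotate) (++-assoc xs ys [ x ]) ⟩
  iter (length xs) rotate (xs ++ ys ++ [ x ])   ≡⟨ iter-rotate-++ xs (ys ++ [ x ]) ⟩
  (ys ++ [ x ]) ++ xs                           ≡⟨ ++-assoc ys [ x ] xs ⟩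
  ys ++ x ∷ xs                                  ∎
  where open ≡-Reasoning

s-free-rotate : ∀ {c f I π} → Peaks c f I π → Unique π → 1 ≤ length I → length I ≤ 2 →
  free c (s π) ≡ rotate (free c π)
s-free-rotate {zero} {I = _ ∷ []}         (base _) _ _ _ = refl
s-free-rotate {zero} {I = _ ∷ _ ∷ []}     (base _) _ _ _ = refl
s-free-rotate {zero} {I = _ ∷ _ ∷ _ ∷ _} (base _) _ _ (s≤s (s≤s ()))
s-free-rotate {suc c} {I = b ∷ I} (peak {A = A} {M} {e} L e<f M≡) unique |I|≥1 |I|≤2
  with s-++-peak M e L e<f M≡ unique | Peaks-free L
... | X , sA , sπ | E , freeA
  with s-Peaks L (Unique-++⁻ˡ A unique) (s≤s z≤n)
... | J , LJ , _ with free-replaceLast LJ X b e sA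
... | G , free-Xb , free-Xe = begin
  free (suc c) (s (A ++ M ∷ e ∷ []))        ≡⟨ cong (free (suc c)) sπ ⟩
  free (suc c) ((X ++ [ e ]) ++ M ∷ b ∷ []) ≡⟨ free-peak c (X ++ [ e ]) M b ⟩
  free c (X ++ [ e ]) ++ [ b ]              ≡⟨ cong (_++ [ b ]) free-Xe ⟩
  (G ++ [ e ]) ++ [ b ]                     ≡⟨ cong (λ z → (z ++ [ e ]) ++ [ b ]) G≡ ⟩
  ((I ++ E) ++ [ e ]) ++ [ b ]              ≡⟨ cong (_++ [ b ]) (++-assoc I E [ e ]) ⟩
  rotate (b ∷ I ++ E ++ [ e ])              ≡⟨ cong rotate (sym freeπ) ⟩
  rotate (free (suc c) (A ++ M ∷ e ∷ []))   ∎
  where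
  open ≡-Reasoning
  freeπ : free (suc c) (A ++ M ∷ e ∷ []) ≡ b ∷ I ++ E ++ [ e ]
  freeπ = trans (free-peak c A M e) (trans (cong (_++ [ e ]) freeA) (++-assoc (b ∷ I) E [ e ]))
  G≡ : G ≡ I ++ E
  G≡ = ∷ʳ-injectiveˡ G (I ++ E)
         (trans (sym free-Xb) (trans (cong (free c) (sym sA))
                (trans (s-free-rotate L (Unique-++⁻ˡ A unique) |I|≥1 |I|≤2) (cong rotate freeA))))

iter-s-free : ∀ {c f I π} → Peaks c f I π → Unique π → 1 ≤ length I → length I ≤ 2 →
  ∀ j → free c (iter j s π) ≡ iter j rotate (free c π)
iter-s-free L unique |I|≥1 |I|≤2 zero = refl
iter-s-free {π = π} L unique |I|≥1 |I|≤2 (suc j) with iter-s-Peaks j L unique |I|≥1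
... | I′ , L′ , |I′| =
  trans (s-free-rotate L′ (Unique-resp-↭ (↭-sym (iter-s-↭ j π)) unique)
                      (subst (1 ≤_) (sym |I′|) |I|≥1) (subst (_≤ 2) (sym |I′|) |I|≤2))
        (cong rotate (iter-s-free L unique |I|≥1 |I|≤2 j))

Peaks-periodic : ∀ {c f I π} → Peaks c f I π → Unique π → 1 ≤ length I → length I ≤ 2 → Periodic s π
Peaks-periodic {c} {f} {I} {π} L unique |I|≥1 |I|≤2 with Peaks-free L
... | E , freeπ with iter-s-Peaks (length (free c π)) L unique |I|≥1
... | _ , L′ , _ = length (free c π) , period>0 , Peaks-free-injective L′ L freeBack
  where
  period>0 : 0 < length (free c π)
  period>0 = subst (0 <_) (cong length (sym freeπ)) (≤-trans |I|≥1 (length-++-≤ˡ I))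
  freeBack : free c (iter (length (free c π)) s π) ≡ free c π
  freeBack = begin
    free c (iter (length (free c π)) s π)         ≡⟨ iter-s-free L unique |I|≥1 |I|≤2 (length (free c π)) ⟩
    iter (length (free c π)) rotate (free c π)    ≡⟨ cong (λ F → iter (length F) rotate F) freeπ ⟩
    iter (length (I ++ E)) rotate (I ++ E)        ≡⟨ cong (iter (length (I ++ E)) rotate) (sym (++-identityʳ (I ++ E))) ⟩
    iter (length (I ++ E)) rotate ((I ++ E) ++ []) ≡⟨ iter-rotate-++ (I ++ E) [] ⟩
    I ++ E                                         ≡⟨ sym freeπ ⟩
    free c π                                       ∎
    where open ≡-Reasoning

-- Peaks read off positions

at-++ : ∀ A B p → 1 ≤ p → p ≤ length A → at (A ++ B) p ≡ at A p
at-++ (x ∷ A) B (suc zero)    _ _         = refl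
at-++ (x ∷ A) B (suc (suc p)) _ (s≤s p≤) = at-++ A B (suc p) (s≤s z≤n) p≤

at-peak : ∀ A M e → at (A ++ M ∷ e ∷ []) (suc (length A)) ≡ M
at-peak []      M e = refl
at-peak (x ∷ A) M e = at-peak A M e

at-∈ : ∀ A p → 1 ≤ p → p ≤ length A → at A p ∈ A
at-∈ (x ∷ A) (suc zero)    _ _         = here refl
at-∈ (x ∷ A) (suc (suc p)) _ (s≤s p≤) = there (at-∈ A (suc p) (s≤s z≤n) p≤)

at-map : ∀ (h : ℕ → ℕ) π p → 1 ≤ p → p ≤ length π → at (map h π) p ≡ h (at π p)
at-map h (x ∷ π) (suc zero)    _ _         = refl
at-map h (x ∷ π) (suc (suc p)) _ (s≤s p≤) = at-map h π (suc p) (s≤s z≤n) p≤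

All-at : ∀ {P : ℕ → Set} π p → All P π → 1 ≤ p → p ≤ length π → P (at π p)
All-at (x ∷ π) (suc zero)    (px ∷ _)  _ _         = px
All-at (x ∷ π) (suc (suc p)) (_ ∷ pπ) _ (s≤s p≤) = All-at π (suc p) pπ (s≤s z≤n) p≤

length-peak : ∀ (A : List ℕ) M e → length (A ++ M ∷ e ∷ []) ≡ suc (suc (length A))
length-peak A M e = trans (length-++ A) (+-comm (length A) 2)

twice<double : ∀ {i c} → i < c → suc (suc (twice i)) ≤ c + c
twice<double {zero}  {suc c} _          = s≤s (subst (1 ≤_) (sym (+-suc c c)) (s≤s z≤n))
twice<double {suc i} {suc c} (s≤s i<c) = s≤s (subst (suc (suc (suc (twice i))) ≤_) (sym (+-suc c c)) (s≤s (twice<double i<c)))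

peakPosition≥1 : ∀ {i c} L → i < c → suc (c + c) ≤ L → 1 ≤ L ∸ suc (twice i)
peakPosition≥1 L i<c 2c<L = m<n⇒0<n∸m (≤-trans (twice<double i<c) (≤-trans (n≤1+n _) 2c<L))

Peaks-length≥ : ∀ {c f I π} → Peaks c f I π → 1 ≤ length I → suc (c + c) ≤ length π
Peaks-length≥ {c} {I = I} L |I|≥1 rewrite Peaks-length L =
  subst (_≤ c + c + length I) (+-comm (c + c) 1) (+-monoʳ-≤ (c + c) |I|≥1)

Peaks-at : ∀ {c f I π} → Peaks c f I π → 1 ≤ length I →
  ∀ i → i < c → at π (length π ∸ suc (twice i)) ≡ c ∸ suc i + f
Peaks-at (peak {A = A} {M} {e} L _ M≡) _ zero _ rewrite length-peak A M e = trans (at-peak A M e) M≡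
Peaks-at {suc c} (peak {A = A} {M} {e} L _ _) |I|≥1 (suc i) (s≤s i<c) rewrite length-peak A M e =
  trans (at-++ A (M ∷ e ∷ []) (length A ∸ suc (twice i)) (peakPosition≥1 (length A) i<c (Peaks-length≥ L |I|≥1))
                                                          (m∸n≤m (length A) (suc (twice i))))
        (Peaks-at L |I|≥1 i i<c)

PeakValues : ℕ → ℕ → List ℕ → Set
PeakValues c N π = ∀ i → i < c → at π (length π ∸ suc (twice i)) ≡ N ∸ i

snoc₂-view : ∀ (π : List ℕ) → 2 ≤ length π → ∃ λ A → ∃₂ λ x y → π ≡ A ++ x ∷ y ∷ []
snoc₂-view (a ∷ [])        (s≤s ())
snoc₂-view (a ∷ b ∷ [])    _ = [] , a , b , refl
snoc₂-view (a ∷ b ∷ c ∷ π) _ with snoc₂-view (b ∷ c ∷ π) (s≤s (s≤s z≤n))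
... | A , x , y , eq = a ∷ A , x , y , cong (a ∷_) eq

PeakValues-peak : ∀ {c N} A x y → suc (c + c) ≤ length A → PeakValues (suc c) (suc N) (A ++ x ∷ y ∷ []) →
  x ≡ suc N × PeakValues c N A
PeakValues-peak {c} {N} A x y |A|≥ values = x≡ , valuesA
  where
  values′ : ∀ i → i < suc c → at (A ++ x ∷ y ∷ []) (suc (suc (length A)) ∸ suc (twice i)) ≡ suc N ∸ i
  values′ i i<1+c = subst (λ L → at (A ++ x ∷ y ∷ []) (L ∸ suc (twice i)) ≡ suc N ∸ i) (length-peak A x y) (values i i<1+c)
  x≡ : x ≡ suc N
  x≡ = trans (sym (at-peak A x y)) (values′ 0 (s≤s z≤n))
  valuesA : PeakValues c N A
  valuesA i i<c = trans (sym (at-++ A (x ∷ y ∷ []) (length A ∸ suc (twice i)) (peakPosition≥1 (length A) i<c |A|≥)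
                                                                            (m∸n≤m (length A) (suc (twice i)))))
                        (values′ (suc i) (s≤s i<c))

∸-below : ∀ {N c y} → suc N ∸ c ≤ y → y ≤ N → N ∸ y < c
∸-below {N} {c} {y} N+1-c≤y y≤N =
  +-cancelʳ-≤ y (suc (N ∸ y)) c (subst (_≤ c + y) (sym (cong suc (m∸n+n≡m y≤N)))
                                       (≤-trans (m≤n+m∸n (suc N) c) (+-monoʳ-≤ c N+1-c≤y)))

PeakValues⇒Peaks : ∀ c N π → Unique π → All (_≤ N) π → suc (c + c) ≤ length π → c ≤ N →
  PeakValues c N π → ∃ λ I → Peaks c (suc N ∸ c) I π
PeakValues⇒Peaks zero    N π _ π≤N _ _ _ = π , base (All.map s≤s π≤N)
PeakValues⇒Peaks (suc c) (suc N) π unique π≤N |π|≥ (s≤s c≤N) values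
  with snoc₂-view π (≤-trans (s≤s (s≤s z≤n)) |π|≥)
... | A , x , y , refl = proj₁ IH , peak (proj₂ IH) y<f (trans x≡ (sym (m+[n∸m]≡n (m≤n⇒m≤1+n c≤N))))
  where
  |A|≥ : suc (c + c) ≤ length A
  |A|≥ = ≤-pred (≤-pred (subst₂ _≤_ (cong (suc ∘ suc) (+-suc c c)) (length-peak A x y) |π|≥))
  x≡ : x ≡ suc N
  x≡ = proj₁ (PeakValues-peak A x y |A|≥ values)
  valuesA : PeakValues c N A
  valuesA = proj₂ (PeakValues-peak A x y |A|≥ values)
  A≢x : All (_≢ x) A
  A≢x = proj₁ (Unique-middle A unique)
  A≤N : All (_≤ N) A
  A≤N = All.zipWith (λ {a} (a≤1+N , a≢x) → m<1+n⇒m≤n (≤∧≢⇒< a≤1+N (subst (a ≢_) x≡ a≢x)))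
                    (All.++⁻ˡ A π≤N , A≢x)
  IH : ∃ λ I → Peaks c (suc N ∸ c) I A
  IH = PeakValues⇒Peaks c N A (Unique-++⁻ˡ A unique) A≤N |A|≥ c≤N valuesA
  y≤N : y ≤ N
  y≤N = m<1+n⇒m≤n (≤∧≢⇒< (All.head (All.tail (All.++⁻ʳ A π≤N)))
                          (subst (y ≢_) x≡ (All.head (proj₂ (Unique-middle A unique)))))
  y<f : y < suc N ∸ c
  y<f with y <? suc N ∸ c
  ... | yes y<N+1-c = y<N+1-c
  ... | no  y≮f = contradiction (subst (_∈ A) y-at (at-∈ A _ (peakPosition≥1 (length A) i<c |A|≥) (m∸n≤m (length A) (suc (twice (N ∸ y))))))
                                (λ y∈A → All.lookup (Unique-last A unique) y∈A refl)
    where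
    i<c : N ∸ y < c
    i<c = ∸-below (≮⇒≥ y≮f) y≤N
    y-at : at A (length A ∸ suc (twice (N ∸ y))) ≡ y
    y-at = trans (valuesA (N ∸ y) i<c) (m∸[m∸n]≡n y≤N)

-- Periodic points among the permutations

IsPerm-length : ∀ {n π} → IsPerm n π → length π ≡ n
IsPerm-length {n} p = trans (↭-length p) (trans (length-map suc (upTo n)) (length-upTo n))

IsPerm-Unique : ∀ {n π} → IsPerm n π → Unique π
IsPerm-Unique {n} p = Unique-resp-↭ (↭-sym p) (Unique.map⁺ suc-injective (Unique.upTo⁺ n))

IsPerm-≤ : ∀ {n π} → IsPerm n π → All (_≤ n) π
IsPerm-≤ {n} p = All-resp-↭ (↭-sym p) (All.map⁺ (All.applyUpTo⁺₁ id n (λ i<n → i<n)))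

IsPerm-∈ : ∀ {n π g} → IsPerm n π → 1 ≤ g → g ≤ n → g ∈ π
IsPerm-∈ {g = suc i} p _ i<n = ∈-resp-↭ (↭-sym p) (∈-map⁺ suc (∈-upTo⁺ i<n))

half-bounds : ∀ n → 1 ≤ n → suc ((n ∸ 1) / 2 + (n ∸ 1) / 2) ≤ n × n ≤ suc (suc ((n ∸ 1) / 2 + (n ∸ 1) / 2))
half-bounds (suc k) _ =
  s≤s (subst (m + m ≤_) (sym k≡) (m≤n+m (m + m) (k % 2))) ,
  s≤s (subst (_≤ suc (m + m)) (sym k≡) (+-monoˡ-≤ (m + m) (m<1+n⇒m≤n (m%n<n k 2))))
  where
  m : ℕ
  m = k / 2
  k≡ : k ≡ k % 2 + (m + m)
  k≡ = trans (m≡m%n+[m/n]*n k 2) (cong (k % 2 +_) (trans (*-comm m 2) (cong (m +_) (+-identityʳ m))))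

Periodic-Peaks : ∀ {n π} → IsPerm n π → Periodic s π → ∀ c → suc (c + c) ≤ n → ∃ λ I → Peaks c (suc n ∸ c) I π
Periodic-Peaks perm _ zero _ = _ , base (All.map s≤s (IsPerm-≤ perm))
Periodic-Peaks {n} {π} perm (k , k>0 , per) (suc c) 2c+3≤n
  with Periodic-Peaks perm (k , k>0 , per) c (≤-trans (s≤s (+-monoʳ-≤ c (n≤1+n c))) (<⇒≤ 2c+3≤n))
... | I , L with Periodic-climb k k>0 per L′ (IsPerm-Unique perm) |I|≥3 (IsPerm-∈ perm (m<n⇒0<n∸m c<n) (m∸n≤m n c))
  where
  c<n : c < n
  c<n = ≤-trans (s≤s (≤-trans (m≤m+n c (suc c)) (n≤1+n _))) 2c+3≤n
  L′ : Peaks c (suc (n ∸ c)) I π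
  L′ = subst (λ f → Peaks c f I π) (+-∸-assoc 1 (<⇒≤ c<n)) L
  |I|≥3 : 3 ≤ length I
  |I|≥3 = +-cancelˡ-≤ (c + c) 3 (length I)
            (subst₂ _≤_ (trans (cong (suc ∘ suc) (+-suc c c)) (+-comm 3 (c + c)))
                        (trans (sym (IsPerm-length perm)) (Peaks-length L)) 2c+3≤n)
... | J , LJ , _ = J , LJ

Periodic⇔PeakValues : ∀ {n π} → IsPerm n π → 1 ≤ n → Periodic s π ⇔ PeakValues ((n ∸ 1) / 2) n π
Periodic⇔PeakValues {n} {π} perm n≥1 = mk⇔ to from
  where
  m : ℕ
  m = (n ∸ 1) / 2
  2m<n : suc (m + m) ≤ n
  2m<n = proj₁ (half-bounds n n≥1)
  m≤n : m ≤ n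
  m≤n = ≤-trans (m≤m+n m m) (≤-trans (n≤1+n _) 2m<n)
  |I|≡ : ∀ {f I} → Peaks m f I π → m + m + length I ≡ n
  |I|≡ L = trans (sym (Peaks-length L)) (IsPerm-length perm)
  |I|≥1 : ∀ {f I} → Peaks m f I π → 1 ≤ length I
  |I|≥1 L = +-cancelˡ-≤ (m + m) 1 _ (subst₂ _≤_ (+-comm 1 (m + m)) (sym (|I|≡ L)) 2m<n)
  to : Periodic s π → PeakValues m n π
  to per i i<m with Periodic-Peaks perm per m 2m<n
  ... | _ , L = trans (Peaks-at L (|I|≥1 L) i i<m) (peakValue i<m m≤n)
    where
    peakValue : ∀ {i m n} → i < m → m ≤ n → m ∸ suc i + (suc n ∸ m) ≡ n ∸ i
    peakValue {zero}  {suc m} {n}     _         m<n       = m+[n∸m]≡n (≤-trans (n≤1+n m) m<n)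
    peakValue {suc i} {suc m} {suc n} (s≤s i<m) (s≤s m≤n) = peakValue i<m m≤n
  from : PeakValues m n π → Periodic s π
  from values with PeakValues⇒Peaks m n π (IsPerm-Unique perm) (IsPerm-≤ perm)
                     (subst (suc (m + m) ≤_) (sym (IsPerm-length perm)) 2m<n) m≤n
                     values
  ... | I , L = Peaks-periodic L (IsPerm-Unique perm) (|I|≥1 L) |I|≤2
    where
    |I|≤2 : length I ≤ 2
    |I|≤2 = +-cancelˡ-≤ (m + m) (length I) 2 (subst₂ _≤_ (sym (|I|≡ L)) (+-comm 2 (m + m)) (proj₂ (half-bounds n n≥1)))

applyUpTo-≡⇔ : ∀ {A : Set} m (h g : ℕ → A) → applyUpTo h m ≡ applyUpTo g m ⇔ (∀ i → i < m → h i ≡ g i)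
applyUpTo-≡⇔ {A} m h g = mk⇔ (to m h g) (from m h g)
  where
  to : ∀ m (h g : ℕ → A) → applyUpTo h m ≡ applyUpTo g m → ∀ i → i < m → h i ≡ g i
  to (suc m) h g eq zero    _         = proj₁ (∷-injective eq)
  to (suc m) h g eq (suc i) (s≤s i<m) = to m (h ∘ suc) (g ∘ suc) (proj₂ (∷-injective eq)) i i<m
  from : ∀ m (h g : ℕ → A) → (∀ i → i < m → h i ≡ g i) → applyUpTo h m ≡ applyUpTo g m
  from zero    h g _   = refl
  from (suc m) h g h≗g = cong₂ _∷_ (h≗g 0 (s≤s z≤n)) (from m (h ∘ suc) (g ∘ suc) (λ i i<m → h≗g (suc i) (s≤s i<m)))

twice≡2* : ∀ i → twice i ≡ 2 * i
twice≡2* zero    = refl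
twice≡2* (suc i) = trans (cong (suc ∘ suc) (twice≡2* i)) (sym (*-suc 2 i))

halfPosition : ∀ n i → n + 1 ∸ 2 * suc i ≡ n ∸ suc (twice i)
halfPosition n i = cong₂ _∸_ (+-comm n 1) (sym (twice≡2* (suc i)))

complement-value : ∀ {n v i} → v ≤ n → i ≤ n → n + 1 ∸ v ≡ suc i ⇔ v ≡ n ∸ i
complement-value {n} {v} {i} v≤n i≤n = mk⇔ to from
  where
  to : n + 1 ∸ v ≡ suc i → v ≡ n ∸ i
  to eq = trans (sym (m∸[m∸n]≡n v≤n))
                (cong (n ∸_) (suc-injective (trans (+-comm 1 (n ∸ v)) (trans (sym (+-∸-comm 1 v≤n)) eq))))
  from : v ≡ n ∸ i → n + 1 ∸ v ≡ suc i
  from refl = trans (+-∸-comm 1 (m∸n≤m n i)) (trans (cong (_+ 1) (m∸[m∸n]≡n i≤n)) (+-comm i 1))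

HalfIncreasing⇔PeakValues : ∀ {n π} → IsPerm n π → 1 ≤ n → HalfIncreasing n π ⇔ PeakValues ((n ∸ 1) / 2) n π
HalfIncreasing⇔PeakValues {n} {π} perm n≥1 = mk⇔ to from
  where
  m : ℕ
  m = (n ∸ 1) / 2
  h : ℕ → ℕ
  h i = at (complement n π) (n + 1 ∸ 2 * suc i)
  |π| : length π ≡ n
  |π| = IsPerm-length perm
  pos≥1 : ∀ {i} → i < m → 1 ≤ n ∸ suc (twice i)
  pos≥1 i<m = peakPosition≥1 n i<m (proj₁ (half-bounds n n≥1))
  pos≤ : ∀ i → n ∸ suc (twice i) ≤ length π
  pos≤ i = subst (n ∸ suc (twice i) ≤_) (sym |π|) (m∸n≤m n (suc (twice i)))
  i≤n : ∀ {i} → i < m → i ≤ n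
  i≤n i<m = ≤-trans (<⇒≤ i<m) (≤-trans (m≤m+n m m) (≤-trans (n≤1+n _) (proj₁ (half-bounds n n≥1))))
  h≡ : ∀ {i} → i < m → h i ≡ n + 1 ∸ at π (n ∸ suc (twice i))
  h≡ {i} i<m rewrite halfPosition n i = at-map (n + 1 ∸_) π (n ∸ suc (twice i)) (pos≥1 i<m) (pos≤ i)
  pointwise : ∀ {i} → i < m → h i ≡ suc i ⇔ at π (length π ∸ suc (twice i)) ≡ n ∸ i
  pointwise {i} i<m rewrite h≡ i<m | |π| =
    complement-value (All-at π (n ∸ suc (twice i)) (IsPerm-≤ perm) (pos≥1 i<m) (pos≤ i)) (i≤n i<m)
  unfold : ∀ (g : ℕ → ℕ) → map g (upTo m) ≡ applyUpTo g m
  unfold g = map-applyUpTo id g m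
  to : HalfIncreasing n π → PeakValues m n π
  to hi i i<m = Equivalence.to (pointwise i<m)
    (Equivalence.to (applyUpTo-≡⇔ m h suc) (trans (sym (unfold h)) (trans hi (unfold suc))) i i<m)
  from : PeakValues m n π → HalfIncreasing n π
  from values = trans (unfold h) (trans (Equivalence.from (applyUpTo-≡⇔ m h suc)
                        (λ i i<m → Equivalence.from (pointwise i<m) (values i i<m))) (sym (unfold suc)))

corollary4p3 : (n : ℕ) → 1 ≤ n → (π : List ℕ) → IsPerm n π →
    (Periodic (sT T312-321) π ⇔ HalfIncreasing n π)
corollary4p3 n n≥1 π perm =
  ⇔-trans (Periodic-sT⇔s π) (⇔-trans (Periodic⇔PeakValues perm n≥1) (⇔-sym (HalfIncreasing⇔PeakValues perm n≥1)))
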